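{- For any integer $k \geq 2$, as formal power series in $q,r,t$, $$C_k(q,r,t) = \frac{\sum_{i \geq 0} \left( C_k(t)^{i+1} - q^{i+1} \right) r^i}{1-q+q^k t}.$$
   Context: For an integer $k\ge 2$ and integers $\alpha,\beta, n\ge 0$, a raised $k$-Dyck path of shape $(\alpha,\beta)$ with $n$ down steps is an integer lattice path from $(0,\alpha)$ to $(kn+\beta-\alpha,\beta)$ using steps $U=(1,1)$ and $D=(1,1-k)$ that stays weakly above the line $y=0$ (it has exactly $n$ steps $D$). Let $C^k_{n,(\alpha,\beta)}$ be the number of such paths (the empty path counts when $n=0$, $\alpha=\beta$). Define $C_k(q,r,t) = \sum_{\alpha,\beta,n \geq 0} C^k_{n,(\alpha,\beta)} q^\alpha r^\beta t^n$. Let $C_k(t)=\sum_{n\ge0} \frac{1}{kn+1}\binom{kn+1}{n} t^n$ be the generating function of the $k$-Catalan numbers; it satisfies $C_k(t)=1+tC_k(t)^k$. -}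

module Defs where

open import Data.Nat as ℕ using (ℕ; zero; suc; _∸_; _≡ᵇ_)
open import Data.Nat.Combinatorics using (_C_)
open import Data.Nat.DivMod using (_/_)
open import Data.Integer as ℤ using (ℤ; +_; _≤ᵇ_)
open import Data.Bool using (Bool; true; false; _∧_; if_then_else_)
open import Data.List using (List; []; _∷_; map; concatMap; filter; length)
open import Relation.Nullary.Decidable using (does)
open import Data.Bool.Properties using (T?)
open import Relation.Binary.PropositionalEquality using (_≡_)

-- U = (1,1), D = (1,1-k)
data Step : Set where
  U D : Step

words : ℕ → List (List Step)
words zero    = [] ∷ []
words (suc L) = concatMap (λ w → (U ∷ w) ∷ (D ∷ w) ∷ []) (words L)

numD : List Step → ℕ
numD []       = 0
numD (U ∷ w)  = numD w
numD (D ∷ w)  = suc (numD w)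

stepH : ℕ → Step → ℤ → ℤ
stepH k U h = h ℤ.+ + 1
stepH k D h = h ℤ.+ (+ 1 ℤ.- + k)

staysAboveEndsAt : ℕ → ℤ → ℤ → List Step → Bool
staysAboveEndsAt k β h []      = (+ 0 ≤ᵇ h) ∧ does (h ℤ.≟ β)
staysAboveEndsAt k β h (s ∷ w) = (+ 0 ≤ᵇ h) ∧ staysAboveEndsAt k β (stepH k s h) w

isRaisedDyck : ℕ → ℕ → ℕ → ℕ → List Step → Bool
isRaisedDyck k n α β w = (numD w ≡ᵇ n) ∧ staysAboveEndsAt k (+ β) (+ α) w

-- C^k_{n,(α,β)}: count of such paths; they have exactly k n + β - α steps
-- (when k n + β < α there is no such path, and the truncated length 0
-- yields no valid word either since the empty word ends at α ≠ β).
dyckCount : ℕ → ℕ → ℕ → ℕ → ℕ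
dyckCount k n α β =
  length (filter (λ w → T? (isRaisedDyck k n α β w)) (words ((k ℕ.* n ℕ.+ β) ∸ α)))

Σ≤ : ℕ → (ℕ → ℤ) → ℤ
Σ≤ zero    f = f 0
Σ≤ (suc n) f = Σ≤ n f ℤ.+ f (suc n)

-- series in one variable t : coefficient of t^n
Series1 : Set
Series1 = ℕ → ℤ

_*₁_ : Series1 → Series1 → Series1
(f *₁ g) n = Σ≤ n (λ j → f j ℤ.* g (n ∸ j))

one₁ : Series1
one₁ zero    = + 1
one₁ (suc n) = + 0

_^₁_ : Series1 → ℕ → Series1
f ^₁ zero  = one₁
f ^₁ suc m = f *₁ (f ^₁ m)

-- series in q, r, t : coefficient of q^a r^b t^n
Series3 : Set
Series3 = ℕ → ℕ → ℕ → ℤ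

_≈₃_ : Series3 → Series3 → Set
F ≈₃ G = ∀ a b n → F a b n ≡ G a b n

_+₃_ _-₃_ _*₃_ : Series3 → Series3 → Series3
(F +₃ G) a b n = F a b n ℤ.+ G a b n
(F -₃ G) a b n = F a b n ℤ.- G a b n
(F *₃ G) a b n =
  Σ≤ a (λ a₁ → Σ≤ b (λ b₁ → Σ≤ n (λ n₁ →
    F a₁ b₁ n₁ ℤ.* G (a ∸ a₁) (b ∸ b₁) (n ∸ n₁))))

mono : ℕ → ℕ → ℕ → Series3
mono i j m a b n =
  if (a ≡ᵇ i) ∧ (b ≡ᵇ j) ∧ (n ≡ᵇ m) then + 1 else + 0

one₃ : Series3
one₃ = mono 0 0 0

embT : Series1 → Series3
embT f a b n = if (a ≡ᵇ 0) ∧ (b ≡ᵇ 0) then f n else + 0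

-- Σ_{i ≥ 0} G_i r^i, where each G_i is free of r (only its r^0 part is used;
-- well-defined as every coefficient receives a single contribution)
sumR : (ℕ → Series3) → Series3
sumR G a b n = (G b *₃ mono 0 b 0) a b n

catalanGF : ℕ → Series1
catalanGF k n = + ((suc (k ℕ.* n) C n) / suc (k ℕ.* n))

dyckGF : ℕ → Series3
dyckGF k α β n = + dyckCount k n α β

numer : ℕ → Series3
numer k = sumR (λ i → embT (catalanGF k ^₁ suc i) -₃ mono (suc i) 0 0)

denom : ℕ → Series3
denom k = (one₃ -₃ mono 1 0 0) +₃ mono k 0 1

module Submission where

-- Write c(α, β, n) for the number of raised paths.  The coefficient of q^α r^β t^n in
-- C_k(q,r,t) (1 - q + q^k t) is c(α, β, n) - c(α - 1, β, n) + c(α - k, β, n - 1).  For α ≥ 1 a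
-- path starting at height α - 1 either begins with U and continues from α, or begins with D and
-- continues from α - k with one down step fewer, or is empty; so the coefficient is
-- -[α = β + 1][n = 0], as in the numerator.  For α = 0 it is c(0, β, n): splitting paths at their
-- last step shows that these numbers obey the recurrence C^(m+1) = C^m + t C^(m+k) of the
-- coefficients of the powers of C = C_k(t), and a closed form in binomial coefficients identifies
-- the first power with the k-Catalan formula.  Hence C_k(q,r,t) (1 - q + q^k t) is the numerator,
-- and multiplying by the inverse E of the denominator (power series multiplication being
-- associative) gives the identity.

open import Algebra.Bundles using (Semiring)
import Algebra.Construct.Pointwise as Pointwise
import Algebra.Properties.CommutativeSemigroup as CommutativeSemigroupProperties
open import Data.Bool using (if_then_else_)
open import Data.Nat using (ℕ; zero; suc; z≤n; _∸_; _≤_; _≡ᵇ_; _≤ᵇ_)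
open import Data.Nat.Properties using (≤-refl; m≤n⇒m≤1+n; +-∸-assoc; n∸n≡0)
open import Data.Product using (_,_)
open import Function using (_∘_)
open import Level using (Level; 0ℓ)
open import Relation.Binary.PropositionalEquality as ≡ using (_≡_)
open import Defs

suc-≤ᵇ-suc : ∀ m n → (suc m ≤ᵇ suc n) ≡ (m ≤ᵇ n)
suc-≤ᵇ-suc zero    n = ≡.refl
suc-≤ᵇ-suc (suc m) n = ≡.refl

module _ {c ℓ : Level} (R : Semiring c ℓ) where

  open Semiring R
  open import Relation.Binary.Reasoning.Setoid setoid

  x*d≈y∧d*e≈1⇒x≈y*e : ∀ {x d y e} → x * d ≈ y → d * e ≈ 1# → x ≈ y * e
  x*d≈y∧d*e≈1⇒x≈y*e {x} {d} {y} {e} x*d≈y d*e≈1 = begin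
    x            ≈⟨ *-identityʳ x ⟨
    x * 1#       ≈⟨ *-cong refl d*e≈1 ⟨
    x * (d * e)  ≈⟨ *-assoc x d e ⟨
    (x * d) * e  ≈⟨ *-cong x*d≈y refl ⟩
    y * e        ∎

module SemiringSums {c ℓ : Level} (R : Semiring c ℓ) where

  open Semiring R
  open CommutativeSemigroupProperties +-commutativeSemigroup using (interchange)
  open import Relation.Binary.Reasoning.Setoid setoid

  sumTo : ℕ → (ℕ → Carrier) → Carrier
  sumTo zero    f = f 0
  sumTo (suc n) f = sumTo n f + f (suc n)

  sumTo-cong : ∀ n {f g} → (∀ i → i ≤ n → f i ≈ g i) → sumTo n f ≈ sumTo n g
  sumTo-cong zero    f≈g = f≈g 0 z≤n
  sumTo-cong (suc n) f≈g =
    +-cong (sumTo-cong n (λ i i≤n → f≈g i (m≤n⇒m≤1+n i≤n))) (f≈g (suc n) ≤-refl)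

  sumTo-zero : ∀ n {f} → (∀ i → i ≤ n → f i ≈ 0#) → sumTo n f ≈ 0#
  sumTo-zero zero    f≈0 = f≈0 0 z≤n
  sumTo-zero (suc n) f≈0 = begin
    sumTo n _ + _ ≈⟨ +-cong (sumTo-zero n (λ i i≤n → f≈0 i (m≤n⇒m≤1+n i≤n))) (f≈0 (suc n) ≤-refl) ⟩
    0# + 0#       ≈⟨ +-identityˡ 0# ⟩
    0#            ∎

  sumTo-+ : ∀ n f g → sumTo n (λ i → f i + g i) ≈ sumTo n f + sumTo n g
  sumTo-+ zero    f g = refl
  sumTo-+ (suc n) f g = trans (+-cong (sumTo-+ n f g) refl) (interchange _ _ _ _)

  sumTo-suc : ∀ n f → sumTo (suc n) f ≈ f 0 + sumTo n (f ∘ suc)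
  sumTo-suc zero    f = refl
  sumTo-suc (suc n) f = trans (+-cong (sumTo-suc n f) refl) (+-assoc _ _ _)

  *-distribˡ-sumTo : ∀ n x f → x * sumTo n f ≈ sumTo n (λ i → x * f i)
  *-distribˡ-sumTo zero    x f = refl
  *-distribˡ-sumTo (suc n) x f = trans (distribˡ _ _ _) (+-cong (*-distribˡ-sumTo n x f) refl)

  *-distribʳ-sumTo : ∀ n x f → sumTo n f * x ≈ sumTo n (λ i → f i * x)
  *-distribʳ-sumTo zero    x f = refl
  *-distribʳ-sumTo (suc n) x f = trans (distribʳ _ _ _) (+-cong (*-distribʳ-sumTo n x f) refl)

  -- Both sides sum φ i j l over the triples with i + j + l ≡ n.
  sumTo-triangle : ∀ n (φ : ℕ → ℕ → ℕ → Carrier) →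
    sumTo n (λ m → sumTo m (λ i → φ i (m ∸ i) (n ∸ m))) ≈
    sumTo n (λ i → sumTo (n ∸ i) (λ j → φ i j (n ∸ i ∸ j)))
  sumTo-triangle zero    φ = refl
  sumTo-triangle (suc n) φ = begin
    sumTo (suc n) (λ m → sumTo m (λ i → φ i (m ∸ i) (suc n ∸ m)))
      ≈⟨ sumTo-suc n _ ⟩
    φ 0 0 (suc n) + sumTo n (λ m → sumTo (suc m) (λ i → φ i (suc m ∸ i) (n ∸ m)))
      ≈⟨ +-cong refl (sumTo-cong n (λ m _ → sumTo-suc m _)) ⟩
    φ 0 0 (suc n) + sumTo n (λ m → φ 0 (suc m) (n ∸ m) + sumTo m (λ i → φ (suc i) (m ∸ i) (n ∸ m)))
      ≈⟨ +-cong refl (sumTo-+ n _ _) ⟩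
    φ 0 0 (suc n) + (sumTo n (λ m → φ 0 (suc m) (n ∸ m)) + sumTo n (λ m → sumTo m (λ i → φ (suc i) (m ∸ i) (n ∸ m))))
      ≈⟨ sym (+-assoc _ _ _) ⟩
    (φ 0 0 (suc n) + sumTo n (λ m → φ 0 (suc m) (n ∸ m))) + sumTo n (λ m → sumTo m (λ i → φ (suc i) (m ∸ i) (n ∸ m)))
      ≈⟨ +-cong (sym (sumTo-suc n (λ j → φ 0 j (suc n ∸ j)))) (sumTo-triangle n (φ ∘ suc)) ⟩
    sumTo (suc n) (λ j → φ 0 j (suc n ∸ j)) + sumTo n (λ i → sumTo (n ∸ i) (λ j → φ (suc i) j (n ∸ i ∸ j)))
      ≈⟨ sym (sumTo-suc n _) ⟩
    sumTo (suc n) (λ i → sumTo (suc n ∸ i) (λ j → φ i j (suc n ∸ i ∸ j))) ∎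

module _ {c ℓ : Level} (R : Semiring c ℓ) where

  open Semiring R
  open SemiringSums R
  open import Relation.Binary.Reasoning.Setoid setoid

  infixl 7 _⋆_

  _⋆_ : (ℕ → Carrier) → (ℕ → Carrier) → ℕ → Carrier
  (f ⋆ g) n = sumTo n (λ i → f i * g (n ∸ i))

  ⋆-assoc : ∀ f g h n → ((f ⋆ g) ⋆ h) n ≈ (f ⋆ (g ⋆ h)) n
  ⋆-assoc f g h n = begin
    ((f ⋆ g) ⋆ h) n
      ≈⟨ sumTo-cong n (λ m _ → *-distribʳ-sumTo m _ _) ⟩
    sumTo n (λ m → sumTo m (λ i → (f i * g (m ∸ i)) * h (n ∸ m)))
      ≈⟨ sumTo-cong n (λ m _ → sumTo-cong m (λ i _ → *-assoc _ _ _)) ⟩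
    sumTo n (λ m → sumTo m (λ i → f i * (g (m ∸ i) * h (n ∸ m))))
      ≈⟨ sumTo-triangle n (λ i j l → f i * (g j * h l)) ⟩
    sumTo n (λ i → sumTo (n ∸ i) (λ j → f i * (g j * h (n ∸ i ∸ j))))
      ≈⟨ sumTo-cong n (λ i _ → sym (*-distribˡ-sumTo (n ∸ i) _ _)) ⟩
    (f ⋆ (g ⋆ h)) n ∎

  monomial : ℕ → Carrier → ℕ → Carrier
  monomial i x n = if n ≡ᵇ i then x else 0#

  δ : ℕ → Carrier
  δ = monomial 0 1#

  ⋆-monomial : ∀ f i x n → (f ⋆ monomial i x) n ≈ (if i ≤ᵇ n then f (n ∸ i) * x else 0#)
  ⋆-monomial f zero    x zero    = refl
  ⋆-monomial f zero    x (suc n) = begin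
    (f ⋆ monomial 0 x) (suc n)
      ≈⟨ +-cong (sumTo-zero n (λ i i≤n → trans (*-cong refl (reflexive (≡.cong (monomial 0 x) (+-∸-assoc 1 i≤n))))
                                               (zeroʳ _)))
                (*-cong refl (reflexive (≡.cong (monomial 0 x) (n∸n≡0 (suc n))))) ⟩
    0# + f (suc n) * x ≈⟨ +-identityˡ _ ⟩
    f (suc n) * x      ∎
  ⋆-monomial f (suc i) x zero    = zeroʳ (f 0)
  ⋆-monomial f (suc i) x (suc n) = begin
    (f ⋆ monomial (suc i) x) (suc n)
      ≈⟨ +-cong (sumTo-cong n (λ j j≤n → *-cong refl (reflexive (≡.cong (monomial (suc i) x) (+-∸-assoc 1 j≤n)))))
                (*-cong refl (reflexive (≡.cong (monomial (suc i) x) (n∸n≡0 (suc n))))) ⟩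
    (f ⋆ monomial i x) n + f (suc n) * 0#   ≈⟨ +-cong (⋆-monomial f i x n) (zeroʳ _) ⟩
    (if i ≤ᵇ n then f (n ∸ i) * x else 0#) + 0#   ≈⟨ +-identityʳ _ ⟩
    (if i ≤ᵇ n then f (n ∸ i) * x else 0#)  ≡⟨ ≡.cong (if_then f (n ∸ i) * x else 0#) (suc-≤ᵇ-suc i n) ⟨
    (if suc i ≤ᵇ suc n then f (suc n ∸ suc i) * x else 0#) ∎

  ⋆-identityˡ : ∀ f n → (δ ⋆ f) n ≈ f n
  ⋆-identityˡ f zero    = *-identityˡ (f 0)
  ⋆-identityˡ f (suc n) = begin
    (δ ⋆ f) (suc n)                                 ≈⟨ sumTo-suc n _ ⟩
    1# * f (suc n) + sumTo n (λ i → 0# * f (n ∸ i)) ≈⟨ +-cong (*-identityˡ _) (sumTo-zero n (λ i _ → zeroˡ _)) ⟩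
    f (suc n) + 0#                                  ≈⟨ +-identityʳ _ ⟩
    f (suc n)                                       ∎

  ⋆-identityʳ : ∀ f n → (f ⋆ δ) n ≈ f n
  ⋆-identityʳ f n = trans (⋆-monomial f 0 1# n) (*-identityʳ (f n))

  powerSeriesSemiring : Semiring c ℓ
  powerSeriesSemiring = record
    { Carrier = ℕ → Carrier
    ; _≈_ = λ f g → ∀ n → f n ≈ g n
    ; _+_ = λ f g n → f n + g n
    ; _*_ = _⋆_
    ; 0# = λ _ → 0#
    ; 1# = δ
    ; isSemiring = record
      { isSemiringWithoutAnnihilatingZero = record
        { +-isCommutativeMonoid = Pointwise.isCommutativeMonoid ℕ +-isCommutativeMonoid
        ; *-cong = λ f≈g u≈v n → sumTo-cong n (λ i _ → *-cong (f≈g i) (u≈v (n ∸ i)))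
        ; *-assoc = ⋆-assoc
        ; *-identity = ⋆-identityˡ , ⋆-identityʳ
        ; distrib = (λ f g h n → trans (sumTo-cong n (λ i _ → distribˡ _ _ _)) (sumTo-+ n _ _))
                  , (λ f g h n → trans (sumTo-cong n (λ i _ → distribʳ _ _ _)) (sumTo-+ n _ _))
        }
      ; zero = (λ f n → sumTo-zero n (λ i _ → zeroˡ _)) , (λ f n → sumTo-zero n (λ i _ → zeroʳ _))
      }
    }

  sumTo-apply : ∀ n φ m → SemiringSums.sumTo powerSeriesSemiring n φ m ≡ sumTo n (λ i → φ i m)
  sumTo-apply zero    φ m = ≡.refl
  sumTo-apply (suc n) φ m = ≡.cong (_+ φ (suc n) m) (sumTo-apply n φ m)

open import Data.Bool using (Bool; true; false; _∧_)
open import Data.Nat using (s≤s; _+_; _*_; _<_)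
open import Data.Bool.Properties using (if-float; if-eta; if-∧; ∧-zeroʳ; ∧-identityʳ)
open import Data.Empty using (⊥-elim)
open import Data.Integer as ℤ using (ℤ; +_; -[1+_]; _⊖_)
import Data.Integer.Properties as ℤ
import Data.Integer.Tactic.RingSolver as ℤ-Solver
open import Data.List using (List; []; _∷_; concatMap; filterᵇ; length)
open import Data.Nat.Combinatorics using (_C_; nCn≡1; nCk+nC[k+1]≡[n+1]C[k+1])
open import Data.Nat.DivMod using (_/_; m*n/n≡m)
import Data.Nat.Properties as ℕ
import Data.Nat.Tactic.RingSolver as ℕ-Solver
open import Relation.Nullary using (yes; no; ofʸ; ofⁿ; Reflects)
open import Relation.Nullary.Reflects using (fromEquivalence)
open import Relation.Binary.PropositionalEquality
open ≡-Reasoning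

if-+ : ∀ b x y → (if b then x + y else 0) ≡ (if b then x else 0) + (if b then y else 0)
if-+ true  x y = refl
if-+ false x y = refl

≡ᵇ-reflects-≡ : ∀ m n → Reflects (m ≡ n) (m ≡ᵇ n)
≡ᵇ-reflects-≡ m n = fromEquivalence (ℕ.≡ᵇ⇒≡ m n) (ℕ.≡⇒≡ᵇ m n)

≢⇒≡ᵇ≡false : ∀ {m n} → m ≢ n → (m ≡ᵇ n) ≡ false
≢⇒≡ᵇ≡false {m} {n} m≢n with m ≡ᵇ n | ≡ᵇ-reflects-≡ m n
... | true  | ofʸ m≡n = ⊥-elim (m≢n m≡n)
... | false | _       = refl

+-≡ᵇ-cancelˡ : ∀ k m n → (k + m ≡ᵇ k + n) ≡ (m ≡ᵇ n)
+-≡ᵇ-cancelˡ zero    m n = refl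
+-≡ᵇ-cancelˡ (suc k) m n = +-≡ᵇ-cancelˡ k m n

∸-suc : ∀ {m n} → suc m ≤ n → n ∸ m ≡ suc (n ∸ suc m)
∸-suc {m} {suc n} (s≤s m≤n) = ℕ.+-∸-assoc 1 m≤n

ℤ⟦t⟧ ℤ⟦r,t⟧ ℤ⟦q,r,t⟧ : Semiring 0ℓ 0ℓ
ℤ⟦t⟧     = powerSeriesSemiring ℤ.+-*-semiring
ℤ⟦r,t⟧   = powerSeriesSemiring ℤ⟦t⟧
ℤ⟦q,r,t⟧ = powerSeriesSemiring ℤ⟦r,t⟧

open Semiring ℤ⟦q,r,t⟧ using () renaming (_*_ to _⋆₃_; 1# to 1₃)

sumTo≡Σ≤ : ∀ n f → SemiringSums.sumTo ℤ.+-*-semiring n f ≡ Σ≤ n f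
sumTo≡Σ≤ zero    f = refl
sumTo≡Σ≤ (suc n) f = cong (ℤ._+ f (suc n)) (sumTo≡Σ≤ n f)

*₃≡⋆₃ : ∀ F G a b n → (F *₃ G) a b n ≡ (F ⋆₃ G) a b n
*₃≡⋆₃ F G a b n = sym (begin
  (F ⋆₃ G) a b n
    ≡⟨ cong (λ h → h n) (sumTo-apply ℤ⟦t⟧ a _ b) ⟩
  SemiringSums.sumTo ℤ⟦t⟧ a (λ a₁ → _⋆_ ℤ⟦t⟧ (F a₁) (G (a ∸ a₁)) b) n
    ≡⟨ sumTo-apply ℤ.+-*-semiring a _ n ⟩
  SemiringSums.sumTo ℤ.+-*-semiring a (λ a₁ → _⋆_ ℤ⟦t⟧ (F a₁) (G (a ∸ a₁)) b n)
    ≡⟨ sumTo≡Σ≤ a _ ⟩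
  Σ≤ a (λ a₁ → _⋆_ ℤ⟦t⟧ (F a₁) (G (a ∸ a₁)) b n)
    ≡⟨ Σ≤-cong a (λ a₁ → trans (sumTo-apply ℤ.+-*-semiring b _ n)
                        (trans (sumTo≡Σ≤ b _) (Σ≤-cong b (λ b₁ → sumTo≡Σ≤ n _)))) ⟩
  (F *₃ G) a b n ∎)
  where
  Σ≤-cong : ∀ n {f g : ℕ → ℤ} → (∀ i → f i ≡ g i) → Σ≤ n f ≡ Σ≤ n g
  Σ≤-cong zero    f≗g = f≗g 0
  Σ≤-cong (suc n) f≗g = cong₂ ℤ._+_ (Σ≤-cong n f≗g) (f≗g (suc n))

one₃≡1₃ : one₃ ≈₃ 1₃
one₃≡1₃ zero    zero    zero    = refl
one₃≡1₃ zero    zero    (suc n) = refl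
one₃≡1₃ zero    (suc b) n       = refl
one₃≡1₃ (suc a) b       n       = refl

mono≡monomial : ∀ i j m → mono i j m ≈₃ monomial ℤ⟦r,t⟧ i (monomial ℤ⟦t⟧ j (monomial ℤ.+-*-semiring m (+ 1)))
mono≡monomial i j m a b n = begin
  (if (a ≡ᵇ i) ∧ (b ≡ᵇ j) ∧ (n ≡ᵇ m) then + 1 else + 0)
    ≡⟨ trans (if-∧ (a ≡ᵇ i)) (cong (if a ≡ᵇ i then_else + 0) (if-∧ (b ≡ᵇ j))) ⟩
  (if a ≡ᵇ i then (if b ≡ᵇ j then M₁ n else + 0) else + 0)
    ≡⟨ cong (if a ≡ᵇ i then_else + 0) (if-float (λ G → G n) (b ≡ᵇ j) {x = M₁} {y = λ _ → + 0}) ⟨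
  (if a ≡ᵇ i then monomial ℤ⟦t⟧ j M₁ b n else + 0)
    ≡⟨ if-float (λ G → G b n) (a ≡ᵇ i) {x = monomial ℤ⟦t⟧ j M₁} {y = λ _ _ → + 0} ⟨
  monomial ℤ⟦r,t⟧ i (monomial ℤ⟦t⟧ j M₁) a b n ∎
  where
  M₁ = monomial ℤ.+-*-semiring m (+ 1)

*₃-mono : ∀ F i j m a b n → (F *₃ mono i j m) a b n ≡
  (if i ≤ᵇ a then (if j ≤ᵇ b then (if m ≤ᵇ n then F (a ∸ i) (b ∸ j) (n ∸ m) else + 0) else + 0) else + 0)
*₃-mono F i j m a b n = begin
  (F *₃ mono i j m) a b n
    ≡⟨ *₃≡⋆₃ F (mono i j m) a b n ⟩
  (F ⋆₃ mono i j m) a b n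
    ≡⟨ Semiring.*-cong ℤ⟦q,r,t⟧ {F} {F} (λ _ _ _ → refl) (mono≡monomial i j m) a b n ⟩
  (F ⋆₃ monomial ℤ⟦r,t⟧ i M₂) a b n
    ≡⟨ ⋆-monomial ℤ⟦r,t⟧ F i M₂ a b n ⟩
  (if i ≤ᵇ a then _⋆_ ℤ⟦t⟧ (F (a ∸ i)) M₂ else (λ _ _ → + 0)) b n
    ≡⟨ if-float (λ G → G b n) (i ≤ᵇ a) {x = _⋆_ ℤ⟦t⟧ (F (a ∸ i)) M₂} {y = λ _ _ → + 0} ⟩
  (if i ≤ᵇ a then _⋆_ ℤ⟦t⟧ (F (a ∸ i)) M₂ b n else + 0)
    ≡⟨ cong (if i ≤ᵇ a then_else + 0)
            (trans (⋆-monomial ℤ⟦t⟧ (F (a ∸ i)) j M₁ b n)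
                   (if-float (λ G → G n) (j ≤ᵇ b) {x = _⋆_ ℤ.+-*-semiring (F (a ∸ i) (b ∸ j)) M₁} {y = λ _ → + 0})) ⟩
  (if i ≤ᵇ a then (if j ≤ᵇ b then _⋆_ ℤ.+-*-semiring (F (a ∸ i) (b ∸ j)) M₁ n else + 0) else + 0)
    ≡⟨ cong (λ z → if i ≤ᵇ a then (if j ≤ᵇ b then z else + 0) else + 0)
            (trans (⋆-monomial ℤ.+-*-semiring (F (a ∸ i) (b ∸ j)) m (+ 1) n)
                   (cong (if m ≤ᵇ n then_else + 0) (ℤ.*-identityʳ _))) ⟩
  (if i ≤ᵇ a then (if j ≤ᵇ b then (if m ≤ᵇ n then F (a ∸ i) (b ∸ j) (n ∸ m) else + 0) else + 0) else + 0) ∎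
  where
  M₁ = monomial ℤ.+-*-semiring m (+ 1)
  M₂ = monomial ℤ⟦t⟧ j M₁

*₃-distribˡ-+₃ : ∀ F G H a b n → (F *₃ (G +₃ H)) a b n ≡ (F *₃ G) a b n ℤ.+ (F *₃ H) a b n
*₃-distribˡ-+₃ F G H a b n = begin
  (F *₃ (G +₃ H)) a b n                  ≡⟨ *₃≡⋆₃ F (G +₃ H) a b n ⟩
  (F ⋆₃ (G +₃ H)) a b n                  ≡⟨ Semiring.distribˡ ℤ⟦q,r,t⟧ F G H a b n ⟩
  (F ⋆₃ G) a b n ℤ.+ (F ⋆₃ H) a b n      ≡⟨ cong₂ ℤ._+_ (*₃≡⋆₃ F G a b n) (*₃≡⋆₃ F H a b n) ⟨
  (F *₃ G) a b n ℤ.+ (F *₃ H) a b n      ∎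

*₃-distribˡ-minus₃ : ∀ F G H a b n → (F *₃ (G -₃ H)) a b n ≡ (F *₃ G) a b n ℤ.- (F *₃ H) a b n
*₃-distribˡ-minus₃ F G H a b n = begin
  (F *₃ (G -₃ H)) a b n
    ≡⟨ x≡x+y-y _ _ ⟩
  (F *₃ (G -₃ H)) a b n ℤ.+ (F *₃ H) a b n ℤ.- (F *₃ H) a b n
    ≡⟨ cong (ℤ._- (F *₃ H) a b n) (*₃-distribˡ-+₃ F (G -₃ H) H a b n) ⟨
  (F *₃ ((G -₃ H) +₃ H)) a b n ℤ.- (F *₃ H) a b n
    ≡⟨ cong (ℤ._- (F *₃ H) a b n) G-H+H ⟩
  (F *₃ G) a b n ℤ.- (F *₃ H) a b n ∎
  where
  x≡x+y-y : ∀ x y → x ≡ x ℤ.+ y ℤ.- y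
  x≡x+y-y = ℤ-Solver.solve-∀
  x-y+y≡x : ∀ x y → x ℤ.- y ℤ.+ y ≡ x
  x-y+y≡x = ℤ-Solver.solve-∀
  G-H+H : (F *₃ ((G -₃ H) +₃ H)) a b n ≡ (F *₃ G) a b n
  G-H+H = begin
    (F *₃ ((G -₃ H) +₃ H)) a b n ≡⟨ *₃≡⋆₃ F ((G -₃ H) +₃ H) a b n ⟩
    (F ⋆₃ ((G -₃ H) +₃ H)) a b n ≡⟨ Semiring.*-cong ℤ⟦q,r,t⟧ {F} {F} (λ _ _ _ → refl)
                                      (λ a b n → x-y+y≡x (G a b n) (H a b n)) a b n ⟩
    (F ⋆₃ G) a b n               ≡⟨ *₃≡⋆₃ F G a b n ⟨
    (F *₃ G) a b n               ∎

*₁≡⋆ : ∀ f g n → (f *₁ g) n ≡ _⋆_ ℤ.+-*-semiring f g n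
*₁≡⋆ f g n = sym (sumTo≡Σ≤ n _)

count : {A : Set} → (A → Bool) → List A → ℕ
count B xs = length (filterᵇ B xs)

module _ {A : Set} where

  count-∷ : ∀ (B : A → Bool) x xs → count B (x ∷ xs) ≡ (if B x then 1 else 0) + count B xs
  count-∷ B x xs with B x
  ... | true  = refl
  ... | false = refl

  count-cong : ∀ {B B′ : A → Bool} xs → (∀ x → B x ≡ B′ x) → count B xs ≡ count B′ xs
  count-cong {B} {B′} []       B≗B′ = refl
  count-cong {B} {B′} (x ∷ xs) B≗B′ = begin
    count B (x ∷ xs)                          ≡⟨ count-∷ B x xs ⟩
    (if B x then 1 else 0) + count B xs       ≡⟨ cong₂ (λ b c → (if b then 1 else 0) + c) (B≗B′ x) (count-cong xs B≗B′) ⟩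
    (if B′ x then 1 else 0) + count B′ xs     ≡⟨ count-∷ B′ x xs ⟨
    count B′ (x ∷ xs)                         ∎

  count-none : ∀ {B : A → Bool} xs → (∀ x → B x ≡ false) → count B xs ≡ 0
  count-none {B} []       B≗false = refl
  count-none {B} (x ∷ xs) B≗false =
    trans (count-∷ B x xs) (cong₂ (λ b c → (if b then 1 else 0) + c) (B≗false x) (count-none xs B≗false))

  count-concatMap-pair : ∀ (B : A → Bool) (u v : A → A) xs →
    count B (concatMap (λ x → u x ∷ v x ∷ []) xs) ≡ count (B ∘ u) xs + count (B ∘ v) xs
  count-concatMap-pair B u v []       = refl
  count-concatMap-pair B u v (x ∷ xs) = begin
    count B (u x ∷ v x ∷ concatMap _ xs)
      ≡⟨ count-∷ B (u x) _ ⟩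
    ι (u x) + count B (v x ∷ concatMap _ xs)
      ≡⟨ cong (λ c → ι (u x) + c) (count-∷ B (v x) _) ⟩
    ι (u x) + (ι (v x) + count B (concatMap _ xs))
      ≡⟨ cong (λ c → ι (u x) + (ι (v x) + c)) (count-concatMap-pair B u v xs) ⟩
    ι (u x) + (ι (v x) + (count (B ∘ u) xs + count (B ∘ v) xs))
      ≡⟨ interchange (ι (u x)) (ι (v x)) (count (B ∘ u) xs) (count (B ∘ v) xs) ⟩
    (ι (u x) + count (B ∘ u) xs) + (ι (v x) + count (B ∘ v) xs)
      ≡⟨ cong₂ _+_ (count-∷ (B ∘ u) x xs) (count-∷ (B ∘ v) x xs) ⟨
    count (B ∘ u) (x ∷ xs) + count (B ∘ v) (x ∷ xs) ∎
    where
    ι : A → ℕ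
    ι y = if B y then 1 else 0
    interchange : ∀ a b c d → a + (b + (c + d)) ≡ (a + c) + (b + d)
    interchange = ℕ-Solver.solve-∀

module Walks (k₁ : ℕ) where

  k : ℕ
  k = suc k₁

  isWalk : ℤ → ℕ → ℤ → List Step → Bool
  isWalk β n h w = (numD w ≡ᵇ n) ∧ staysAboveEndsAt k β h w

  walks : ℤ → ℕ → ℕ → ℤ → ℕ
  walks β L n h = count (isWalk β n h) (words L)

  walksAfterDown : ℤ → ℕ → ℕ → ℤ → ℕ
  walksAfterDown β L zero    h = 0
  walksAfterDown β L (suc n) h = walks β L n h

  walks-suc : ∀ β L n h → walks β (suc L) n h ≡
    (if + 0 ℤ.≤ᵇ h then walks β L n (stepH k U h) + walksAfterDown β L n (stepH k D h) else 0)
  walks-suc β L n h =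
    trans (count-concatMap-pair (isWalk β n h) (U ∷_) (D ∷_) (words L)) (split (+ 0 ℤ.≤ᵇ h) refl n)
    where
    split : ∀ b → (+ 0 ℤ.≤ᵇ h) ≡ b → ∀ n →
      count (isWalk β n h ∘ (U ∷_)) (words L) + count (isWalk β n h ∘ (D ∷_)) (words L) ≡
      (if b then walks β L n (stepH k U h) + walksAfterDown β L n (stepH k D h) else 0)
    split true  h≥0 zero    = cong₂ _+_
      (count-cong (words L) (λ w → cong (λ b → (numD w ≡ᵇ 0) ∧ (b ∧ staysAboveEndsAt k β (stepH k U h) w)) h≥0))
      (count-none (words L) (λ w → refl))
    split true  h≥0 (suc m) = cong₂ _+_
      (count-cong (words L) (λ w → cong (λ b → (numD w ≡ᵇ suc m) ∧ (b ∧ staysAboveEndsAt k β (stepH k U h) w)) h≥0))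
      (count-cong (words L) (λ w → cong (λ b → (numD w ≡ᵇ m) ∧ (b ∧ staysAboveEndsAt k β (stepH k D h) w)) h≥0))
    split false h<0 n       = cong₂ _+_
      (count-none (words L) (λ w →
        trans (cong (λ b → (numD w ≡ᵇ n) ∧ (b ∧ staysAboveEndsAt k β (stepH k U h) w)) h<0) (∧-zeroʳ _)))
      (count-none (words L) (λ w →
        trans (cong (λ b → (suc (numD w) ≡ᵇ n) ∧ (b ∧ staysAboveEndsAt k β (stepH k D h) w)) h<0) (∧-zeroʳ _)))

  walks-negative : ∀ β L n h → walks β L n -[1+ h ] ≡ 0
  walks-negative β zero    zero    h = refl
  walks-negative β zero    (suc n) h = refl
  walks-negative β (suc L) n       h = walks-suc β L n -[1+ h ]

  mutual
    walksℕ : ℕ → ℕ → ℕ → ℕ → ℕ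
    walksℕ β zero    n h = if (0 ≡ᵇ n) ∧ (h ≡ᵇ β) then 1 else 0
    walksℕ β (suc L) n h = walksℕ β L n (suc h) + walksℕStartingDown β L n h

    walksℕStartingDown : ℕ → ℕ → ℕ → ℕ → ℕ
    walksℕStartingDown β L zero    h = 0
    walksℕStartingDown β L (suc n) h = if k₁ ≤ᵇ h then walksℕ β L n (h ∸ k₁) else 0

  walks≡walksℕ : ∀ β L n h → walks (+ β) L n (+ h) ≡ walksℕ β L n h
  walks≡walksℕ β zero    n h = trans (count-∷ (isWalk (+ β) n (+ h)) [] []) (ℕ.+-identityʳ _)
  walks≡walksℕ β (suc L) n h = trans (walks-suc (+ β) L n (+ h))
    (cong₂ _+_ (trans (cong (walks (+ β) L n ∘ +_) (ℕ.+-comm h 1)) (walks≡walksℕ β L n (suc h)))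
               (trans (cong (walksAfterDown (+ β) L n) (down-step h)) (startingDown n)))
    where
    down-step : ∀ h → + h ℤ.+ (+ 1 ℤ.- + k) ≡ h ⊖ k₁
    down-step h = trans (sym (ℤ.+-assoc (+ h) (+ 1) (ℤ.- + k)))
      (trans (cong (λ z → + z ℤ.+ ℤ.- + k) (ℕ.+-comm h 1))
      (trans (ℤ.m-n≡m⊖n (suc h) k) (ℤ.[1+m]⊖[1+n]≡m⊖n h k₁)))
    startingDown : ∀ n → walksAfterDown (+ β) L n (h ⊖ k₁) ≡ walksℕStartingDown β L n h
    startingDown zero    = refl
    startingDown (suc m) with k₁ ≤ᵇ h | ℕ.≤ᵇ-reflects-≤ k₁ h
    ... | true  | ofʸ k₁≤h rewrite ℤ.⊖-≥ k₁≤h = walks≡walksℕ β L m (h ∸ k₁)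
    ... | false | ofⁿ k₁≰h rewrite ℤ.⊖-< (ℕ.≰⇒> k₁≰h) | ℕ.+-∸-assoc 1 (ℕ.≰⇒> k₁≰h) =
      walks-negative (+ β) L m (k₁ ∸ suc h)

  walksℕEndingUp : ℕ → ℕ → ℕ → ℕ → ℕ
  walksℕEndingUp zero    L n h = 0
  walksℕEndingUp (suc β) L n h = walksℕ β L n h

  walksℕEndingDown : ℕ → ℕ → ℕ → ℕ → ℕ
  walksℕEndingDown β L zero    h = 0
  walksℕEndingDown β L (suc n) h = walksℕ (β + k₁) L n h

  private
    lands-on : ∀ β h → (if k₁ ≤ᵇ h then (if h ∸ k₁ ≡ᵇ β then 1 else 0) else 0) ≡ (if h ≡ᵇ β + k₁ then 1 else 0)
    lands-on β h with k₁ ≤ᵇ h | ℕ.≤ᵇ-reflects-≤ k₁ h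
    ... | true  | ofʸ k₁≤h = cong (if_then 1 else 0) (sym (begin
      h ≡ᵇ β + k₁                 ≡⟨ cong₂ _≡ᵇ_ (ℕ.m+[n∸m]≡n k₁≤h) (ℕ.+-comm k₁ β) ⟨
      k₁ + (h ∸ k₁) ≡ᵇ k₁ + β     ≡⟨ +-≡ᵇ-cancelˡ k₁ (h ∸ k₁) β ⟩
      h ∸ k₁ ≡ᵇ β                 ∎))
    ... | false | ofⁿ k₁≰h with h ≡ᵇ β + k₁ | ≡ᵇ-reflects-≡ h (β + k₁)
    ...   | true  | ofʸ refl = ⊥-elim (k₁≰h (ℕ.m≤n+m k₁ β))
    ...   | false | _        = refl

    startingDown-shift : ∀ β L n h →
      (if k₁ ≤ᵇ h then walksℕEndingDown β L n (h ∸ k₁) else 0) ≡ walksℕStartingDown (β + k₁) L n h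
    startingDown-shift β L zero    h = if-eta (k₁ ≤ᵇ h)
    startingDown-shift β L (suc n) h = refl

    down-to-empty : ∀ β n h → (if k₁ ≤ᵇ h then walksℕ β 0 n (h ∸ k₁) else 0) ≡ walksℕ (β + k₁) 0 n h
    down-to-empty β zero    h = lands-on β h
    down-to-empty β (suc n) h = if-eta (k₁ ≤ᵇ h)

  walksℕ-last : ∀ L β n h → walksℕ β (suc L) n h ≡ walksℕEndingUp β L n h + walksℕEndingDown β L n h
  walksℕ-last zero    zero    zero    h = refl
  walksℕ-last zero    (suc β) zero    h = refl
  walksℕ-last zero    zero    (suc n) h = down-to-empty 0 n h
  walksℕ-last zero    (suc β) (suc n) h = down-to-empty (suc β) n h
  walksℕ-last (suc L) β       n       h =
    trans (cong (_+ walksℕStartingDown β (suc L) n h) (walksℕ-last L β n (suc h))) (regroup β n)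
    where
    regroup : ∀ β n →
      (walksℕEndingUp β L n (suc h) + walksℕEndingDown β L n (suc h)) + walksℕStartingDown β (suc L) n h ≡
      walksℕEndingUp β (suc L) n h + walksℕEndingDown β (suc L) n h
    regroup zero    zero    = refl
    regroup (suc β) zero    = refl
    regroup zero    (suc n) = cong (λ z → walksℕ k₁ L n (suc h) + z)
      (trans (cong (if k₁ ≤ᵇ h then_else 0) (walksℕ-last L 0 n (h ∸ k₁))) (startingDown-shift 0 L n h))
    regroup (suc β) (suc n) = begin
      (up + up′) + (if k₁ ≤ᵇ h then walksℕ (suc β) (suc L) n (h ∸ k₁) else 0)  ≡⟨ cong (λ z → (up + up′) + z) downFirst ⟩
      (up + up′) + (down + walksℕStartingDown (suc β + k₁) L n h)             ≡⟨ interchange up down up′ _ ⟩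
      (up + down) + (up′ + walksℕStartingDown (suc β + k₁) L n h)             ∎
      where
      up = walksℕ β L (suc n) (suc h)
      up′ = walksℕ (suc β + k₁) L n (suc h)
      down = if k₁ ≤ᵇ h then walksℕ β L n (h ∸ k₁) else 0
      downFirst : (if k₁ ≤ᵇ h then walksℕ (suc β) (suc L) n (h ∸ k₁) else 0) ≡ down + walksℕStartingDown (suc β + k₁) L n h
      downFirst = begin
        (if k₁ ≤ᵇ h then walksℕ (suc β) (suc L) n (h ∸ k₁) else 0)
          ≡⟨ cong (if k₁ ≤ᵇ h then_else 0) (walksℕ-last L (suc β) n (h ∸ k₁)) ⟩
        (if k₁ ≤ᵇ h then walksℕ β L n (h ∸ k₁) + walksℕEndingDown (suc β) L n (h ∸ k₁) else 0)
          ≡⟨ if-+ (k₁ ≤ᵇ h) _ _ ⟩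
        down + (if k₁ ≤ᵇ h then walksℕEndingDown (suc β) L n (h ∸ k₁) else 0)
          ≡⟨ cong (λ z → down + z) (startingDown-shift (suc β) L n h) ⟩
        down + walksℕStartingDown (suc β + k₁) L n h ∎
      interchange : ∀ a b c d → (a + c) + (b + d) ≡ (a + b) + (c + d)
      interchange = ℕ-Solver.solve-∀

  walksℕ-up : ∀ β → walksℕ β β 0 0 ≡ 1
  walksℕ-up zero    = refl
  walksℕ-up (suc β) = trans (walksℕ-last β (suc β) 0 0) (trans (ℕ.+-identityʳ _) (walksℕ-up β))

  -- Walks of shape (h, β) with n down steps; their length k n + β - h is forced.
  raised : ℕ → ℕ → ℕ → ℕ
  raised β n h = walksℕ β ((k * n + β) ∸ h) n h

  dyckCount≡raised : ∀ n α β → dyckCount k n α β ≡ raised β n α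
  dyckCount≡raised n α β = walks≡walksℕ β ((k * n + β) ∸ α) n α

  raised-beyond : ∀ β n h → k * n + β < h → raised β n h ≡ 0
  raised-beyond β n h k*n+β<h = begin
    walksℕ β ((k * n + β) ∸ h) n h               ≡⟨ cong (λ L → walksℕ β L n h) (ℕ.m≤n⇒m∸n≡0 (ℕ.<⇒≤ k*n+β<h)) ⟩
    (if (0 ≡ᵇ n) ∧ (h ≡ᵇ β) then 1 else 0)       ≡⟨ cong (λ b → if (0 ≡ᵇ n) ∧ b then 1 else 0) (≢⇒≡ᵇ≡false h≢β) ⟩
    (if (0 ≡ᵇ n) ∧ false then 1 else 0)          ≡⟨ cong (if_then 1 else 0) (∧-zeroʳ (0 ≡ᵇ n)) ⟩
    0                                            ∎
    where
    h≢β : h ≢ β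
    h≢β refl = ℕ.<-irrefl refl (ℕ.≤-trans k*n+β<h (ℕ.m≤n+m h (k * n)))

  walksℕ≡raised : ∀ β L n h → h + L ≡ k * n + β → walksℕ β L n h ≡ raised β n h
  walksℕ≡raised β L n h h+L≡ = cong (λ L → walksℕ β L n h) (sym (trans (cong (_∸ h) (sym h+L≡)) (ℕ.m+n∸m≡n h L)))

  raisedStartingDown : ℕ → ℕ → ℕ → ℕ
  raisedStartingDown β n h = if k₁ ≤ᵇ h then (if 1 ≤ᵇ n then raised β (n ∸ 1) (h ∸ k₁) else 0) else 0

  -- The last summand counts the empty walk.
  raised-first : ∀ β n h →
    raised β n h ≡ raised β n (suc h) + raisedStartingDown β n h + (if (h ≡ᵇ β) ∧ (n ≡ᵇ 0) then 1 else 0)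
  raised-first β n h with suc h ℕ.≤? k * n + β
  raised-first β zero    h | yes h<L = begin
    walksℕ β (k * 0 + β ∸ h) 0 h
      ≡⟨ cong (λ L → walksℕ β L 0 h) (∸-suc h<L) ⟩
    raised β 0 (suc h) + 0
      ≡⟨ ℕ.+-identityʳ _ ⟨
    raised β 0 (suc h) + 0 + 0
      ≡⟨ cong₂ (λ x y → raised β 0 (suc h) + x + y) (if-eta (k₁ ≤ᵇ h))
               (cong (if_then 1 else 0) (trans (∧-identityʳ (h ≡ᵇ β)) (≢⇒≡ᵇ≡false h≢β))) ⟨
    raised β 0 (suc h) + raisedStartingDown β 0 h + (if (h ≡ᵇ β) ∧ true then 1 else 0) ∎
    where
    h≢β : h ≢ β
    h≢β refl = ℕ.<-irrefl refl (subst (suc h ≤_) (cong (_+ h) (ℕ.*-zeroʳ k)) h<L)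
  raised-first β (suc n) h | yes h<L = begin
    walksℕ β (k * suc n + β ∸ h) (suc n) h
      ≡⟨ cong (λ L → walksℕ β L (suc n) h) (∸-suc h<L) ⟩
    raised β (suc n) (suc h) + walksℕStartingDown β L (suc n) h
      ≡⟨ cong (λ x → raised β (suc n) (suc h) + x) startingDown ⟩
    raised β (suc n) (suc h) + raisedStartingDown β (suc n) h
      ≡⟨ ℕ.+-identityʳ _ ⟨
    raised β (suc n) (suc h) + raisedStartingDown β (suc n) h + 0
      ≡⟨ cong (λ b → raised β (suc n) (suc h) + raisedStartingDown β (suc n) h + (if b then 1 else 0)) (∧-zeroʳ (h ≡ᵇ β)) ⟨
    raised β (suc n) (suc h) + raisedStartingDown β (suc n) h + (if (h ≡ᵇ β) ∧ false then 1 else 0) ∎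
    where
    L = k * suc n + β ∸ suc h
    length-after-down : ∀ d → suc (d + k₁) + L ≡ k * suc n + β → d + L ≡ k * n + β
    length-after-down d eq = ℕ.+-cancelˡ-≡ k _ _ (trans (shuffle d L k₁) (trans eq (unfold k₁ n β)))
      where
      shuffle : ∀ d L k₁ → suc k₁ + (d + L) ≡ suc (d + k₁) + L
      shuffle = ℕ-Solver.solve-∀
      unfold : ∀ k₁ n β → suc k₁ * suc n + β ≡ suc k₁ + (suc k₁ * n + β)
      unfold = ℕ-Solver.solve-∀
    startingDown : walksℕStartingDown β L (suc n) h ≡ raisedStartingDown β (suc n) h
    startingDown with k₁ ≤ᵇ h | ℕ.≤ᵇ-reflects-≤ k₁ h
    ... | true  | ofʸ k₁≤h = walksℕ≡raised β L n (h ∸ k₁)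
      (length-after-down (h ∸ k₁) (trans (cong (λ x → suc x + L) (ℕ.m∸n+n≡m k₁≤h)) (ℕ.m+[n∸m]≡n h<L)))
    ... | false | _        = refl
  raised-first β zero    h | no  h≮L = begin
    walksℕ β (k * 0 + β ∸ h) 0 h
      ≡⟨ cong (λ L → walksℕ β L 0 h) (ℕ.m≤n⇒m∸n≡0 L≤h) ⟩
    (if h ≡ᵇ β then 1 else 0)
      ≡⟨ cong₂ (λ x y → x + y + (if h ≡ᵇ β then 1 else 0))
               (raised-beyond β 0 (suc h) (s≤s L≤h)) (if-eta (k₁ ≤ᵇ h)) ⟨
    raised β 0 (suc h) + raisedStartingDown β 0 h + (if h ≡ᵇ β then 1 else 0)
      ≡⟨ cong (λ b → raised β 0 (suc h) + raisedStartingDown β 0 h + (if b then 1 else 0)) (∧-identityʳ (h ≡ᵇ β)) ⟨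
    raised β 0 (suc h) + raisedStartingDown β 0 h + (if (h ≡ᵇ β) ∧ true then 1 else 0) ∎
    where
    L≤h = ℕ.≮⇒≥ h≮L
  raised-first β (suc n) h | no  h≮L = sym (begin
    raised β (suc n) (suc h) + raisedStartingDown β (suc n) h + (if (h ≡ᵇ β) ∧ false then 1 else 0)
      ≡⟨ cong₂ (λ x y → x + y + (if (h ≡ᵇ β) ∧ false then 1 else 0))
               (raised-beyond β (suc n) (suc h) (s≤s L≤h)) nothing-after-down ⟩
    (if (h ≡ᵇ β) ∧ false then 1 else 0)
      ≡⟨ cong (if_then 1 else 0) (∧-zeroʳ (h ≡ᵇ β)) ⟩
    0
      ≡⟨ cong (λ L → walksℕ β L (suc n) h) (ℕ.m≤n⇒m∸n≡0 L≤h) ⟨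
    raised β (suc n) h ∎)
    where
    L≤h = ℕ.≮⇒≥ h≮L
    nothing-after-down : raisedStartingDown β (suc n) h ≡ 0
    nothing-after-down with k₁ ≤ᵇ h | ℕ.≤ᵇ-reflects-≤ k₁ h
    ... | true  | ofʸ k₁≤h = raised-beyond β n (h ∸ k₁)
      (ℕ.m+n≤o⇒m≤o∸n (suc (k * n + β)) (subst (_≤ h) (shuffle k₁ n β) L≤h))
      where
      shuffle : ∀ k₁ n β → suc k₁ * suc n + β ≡ suc (suc k₁ * n + β) + k₁
      shuffle = ℕ-Solver.solve-∀
    ... | false | _        = refl

pascal : ℕ → ℕ → ℕ
pascal zero    b       = 1
pascal (suc a) zero    = 1
pascal (suc a) (suc b) = pascal a (suc b) + pascal (suc a) b

C≡pascal : ∀ a b → (a + b) C a ≡ pascal a b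
C≡pascal zero    b       = refl
C≡pascal (suc a) zero    = trans (cong (_C suc a) (ℕ.+-identityʳ (suc a))) (nCn≡1 (suc a))
C≡pascal (suc a) (suc b) = begin
  (suc a + suc b) C suc a                    ≡⟨ nCk+nC[k+1]≡[n+1]C[k+1] (a + suc b) a ⟨
  (a + suc b) C a + (a + suc b) C suc a      ≡⟨ cong (λ n → (a + suc b) C a + n C suc a) (ℕ.+-suc a b) ⟩
  (a + suc b) C a + (suc a + b) C suc a      ≡⟨ cong₂ _+_ (C≡pascal a (suc b)) (C≡pascal (suc a) b) ⟩
  pascal a (suc b) + pascal (suc a) b        ∎

pascal-1ˡ : ∀ b → pascal 1 b ≡ suc b
pascal-1ˡ zero    = refl
pascal-1ˡ (suc b) = cong suc (pascal-1ˡ b)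

pascal-1ʳ : ∀ a → pascal a 1 ≡ suc a
pascal-1ʳ zero    = refl
pascal-1ʳ (suc a) = trans (cong (_+ 1) (pascal-1ʳ a)) (ℕ.+-comm (suc a) 1)

pascal-absorb : ∀ a b → suc a * pascal (suc a) b ≡ suc b * pascal a (suc b)
pascal-absorb zero    b       = trans (ℕ.+-identityʳ _) (trans (pascal-1ˡ b) (sym (ℕ.*-identityʳ (suc b))))
pascal-absorb (suc a) zero    = trans (ℕ.*-identityʳ _) (sym (trans (ℕ.+-identityʳ _) (pascal-1ʳ (suc a))))
pascal-absorb (suc a) (suc b) = begin
  suc (suc a) * (X + Y)                ≡⟨ ℕ.*-distribˡ-+ (suc (suc a)) X Y ⟩
  suc (suc a) * X + suc (suc a) * Y    ≡⟨ cong (λ z → suc (suc a) * X + z) (pascal-absorb (suc a) b) ⟩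
  suc (suc a) * X + suc b * X          ≡⟨ regroup a b X ⟩
  suc a * X + suc (suc b) * X          ≡⟨ cong (_+ suc (suc b) * X) (pascal-absorb a (suc b)) ⟩
  suc (suc b) * Z + suc (suc b) * X    ≡⟨ ℕ.*-distribˡ-+ (suc (suc b)) Z X ⟨
  suc (suc b) * (Z + X)                ∎
  where
  X = pascal (suc a) (suc b)
  Y = pascal (suc (suc a)) b
  Z = pascal a (suc (suc b))
  regroup : ∀ a b X → suc (suc a) * X + suc b * X ≡ suc a * X + suc (suc b) * X
  regroup = ℕ-Solver.solve-∀

pascal-absorb′ : ∀ a b → suc a * pascal (suc a) b ≡ (suc a + b) * pascal a b
pascal-absorb′ zero    b       = trans (ℕ.+-identityʳ _) (trans (pascal-1ˡ b) (sym (ℕ.*-identityʳ (suc b))))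
pascal-absorb′ (suc a) zero    = cong (_* 1) (sym (ℕ.+-identityʳ (suc (suc a))))
pascal-absorb′ (suc a) (suc b) = begin
  suc (suc a) * ((Y + W) + Y₁)
    ≡⟨ ℕ.*-distribˡ-+ (suc (suc a)) (Y + W) Y₁ ⟩
  suc (suc a) * (Y + W) + suc (suc a) * Y₁
    ≡⟨ cong (λ z → suc (suc a) * (Y + W) + z) (pascal-absorb′ (suc a) b) ⟩
  suc (suc a) * (Y + W) + (suc (suc a) + b) * W
    ≡⟨ expand a b Y W ⟩
  suc (suc a) * Y + suc (suc a) * W + suc a * W + suc b * W
    ≡⟨ cong (λ z → suc (suc a) * Y + suc (suc a) * W + z + suc b * W) (pascal-absorb a b) ⟩
  suc (suc a) * Y + suc (suc a) * W + suc b * Y + suc b * W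
    ≡⟨ expand′ a b Y W ⟨
  (suc (suc a) + suc b) * (Y + W) ∎
  where
  Y = pascal a (suc b)
  W = pascal (suc a) b
  Y₁ = pascal (suc (suc a)) b
  expand : ∀ a b Y W → suc (suc a) * (Y + W) + (suc (suc a) + b) * W ≡
                       suc (suc a) * Y + suc (suc a) * W + suc a * W + suc b * W
  expand = ℕ-Solver.solve-∀
  expand′ : ∀ a b Y W → (suc (suc a) + suc b) * (Y + W) ≡ suc (suc a) * Y + suc (suc a) * W + suc b * Y + suc b * W
  expand′ = ℕ-Solver.solve-∀

pascal₋ : ℕ → ℕ → ℕ
pascal₋ zero    b = 0
pascal₋ (suc a) b = pascal a b

pascal-suc : ∀ a b → pascal a (suc b) ≡ pascal₋ a (suc b) + pascal a b
pascal-suc zero    b = refl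
pascal-suc (suc a) b = refl

[1+d]*z≡c⇒c/[1+d]≡z : ∀ d (z : ℤ) c → + suc d ℤ.* z ≡ + c → + (c / suc d) ≡ z
[1+d]*z≡c⇒c/[1+d]≡z d (+ z)    c d*z≡c = cong +_ (begin
  c / suc d           ≡⟨ cong (_/ suc d) (ℤ.+-injective (trans (ℤ.pos-* (suc d) z) d*z≡c)) ⟨
  suc d * z / suc d   ≡⟨ cong (_/ suc d) (ℕ.*-comm (suc d) z) ⟩
  z * suc d / suc d   ≡⟨ m*n/n≡m z (suc d) ⟩
  z                   ∎)
[1+d]*z≡c⇒c/[1+d]≡z d -[1+ z ] c ()

module Ballot (k₁ : ℕ) where

  open SemiringSums ℤ.+-*-semiring using (sumTo; sumTo-cong; sumTo-+)

  k : ℕ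
  k = suc k₁

  -- ballot n m is the coefficient of t^n in C_k(t)^m; the recurrence is C^(m+1) = C^m + t C^(m+k).
  ballot : ℕ → ℕ → ℤ
  ballot zero    m       = + 1
  ballot (suc n) zero    = + 0
  ballot (suc n) (suc m) = ballot (suc n) m ℤ.+ ballot n (m + k)

  -- C(n+u, n) - k₁ C(n+u, n-1), which at u = k₁ n + m is ballot n (m + 1).
  closedForm : ℕ → ℕ → ℤ
  closedForm n u = + pascal n u ℤ.- + k₁ ℤ.* + pascal₋ n (suc u)

  closedForm-shift : ∀ n → closedForm n (k₁ * suc n) ≡ closedForm (suc n) (k₁ * suc n)
  closedForm-shift n = sym (begin
    + pascal (suc n) u ℤ.- + k₁ ℤ.* + pascal n (suc u)
      ≡⟨ cong₂ (λ x y → + x ℤ.- + k₁ ℤ.* + y) absorb (pascal-suc n u) ⟩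
    + (k * pascal n u) ℤ.- + k₁ ℤ.* + (pascal₋ n (suc u) + pascal n u)
      ≡⟨ cong (ℤ._- + k₁ ℤ.* (+ pascal₋ n (suc u) ℤ.+ + pascal n u)) (ℤ.pos-* k (pascal n u)) ⟩
    (+ 1 ℤ.+ + k₁) ℤ.* + pascal n u ℤ.- + k₁ ℤ.* (+ pascal₋ n (suc u) ℤ.+ + pascal n u)
      ≡⟨ simplify (+ k₁) (+ pascal n u) (+ pascal₋ n (suc u)) ⟩
    closedForm n u ∎)
    where
    u = k₁ * suc n
    absorb : pascal (suc n) u ≡ k * pascal n u
    absorb = ℕ.*-cancelˡ-≡ (pascal (suc n) u) (k * pascal n u) (suc n) (begin
      suc n * pascal (suc n) u  ≡⟨ pascal-absorb′ n u ⟩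
      (suc n + u) * pascal n u  ≡⟨ cong (_* pascal n u) (ℕ.*-comm k (suc n)) ⟩
      (suc n * k) * pascal n u  ≡⟨ ℕ.*-assoc (suc n) k (pascal n u) ⟩
      suc n * (k * pascal n u)  ∎)
    simplify : ∀ K x y → (+ 1 ℤ.+ K) ℤ.* x ℤ.- K ℤ.* (y ℤ.+ x) ≡ x ℤ.- K ℤ.* y
    simplify = ℤ-Solver.solve-∀

  closedForm-step : ∀ n u → closedForm (suc n) u ℤ.+ closedForm n (suc u) ≡ closedForm (suc n) (suc u)
  closedForm-step n u = begin
    (+ pascal (suc n) u ℤ.- + k₁ ℤ.* + pascal n (suc u)) ℤ.+ (+ pascal n (suc u) ℤ.- + k₁ ℤ.* + pascal₋ n (suc (suc u)))
      ≡⟨ regroup (+ k₁) (+ pascal (suc n) u) (+ pascal n (suc u)) (+ pascal₋ n (suc (suc u))) ⟩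
    (+ pascal n (suc u) ℤ.+ + pascal (suc n) u) ℤ.- + k₁ ℤ.* (+ pascal₋ n (suc (suc u)) ℤ.+ + pascal n (suc u))
      ≡⟨ cong (λ z → (+ pascal n (suc u) ℤ.+ + pascal (suc n) u) ℤ.- + k₁ ℤ.* + z) (pascal-suc n (suc u)) ⟨
    closedForm (suc n) (suc u) ∎
    where
    regroup : ∀ K a b d → (a ℤ.- K ℤ.* b) ℤ.+ (b ℤ.- K ℤ.* d) ≡ (b ℤ.+ a) ℤ.- K ℤ.* (d ℤ.+ b)
    regroup = ℤ-Solver.solve-∀

  ballot-closedForm : ∀ n m → ballot n (suc m) ≡ closedForm n (k₁ * n + m)
  ballot-closedForm zero    m       = sym (cong (λ z → + 1 ℤ.- z) (ℤ.*-zeroʳ (+ k₁)))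
  ballot-closedForm (suc n) zero    = begin
    + 0 ℤ.+ ballot n k                ≡⟨ ℤ.+-identityˡ _ ⟩
    ballot n (suc k₁)                 ≡⟨ ballot-closedForm n k₁ ⟩
    closedForm n (k₁ * n + k₁)        ≡⟨ cong (closedForm n) (trans (ℕ.+-comm (k₁ * n) k₁) (sym (ℕ.*-suc k₁ n))) ⟩
    closedForm n (k₁ * suc n)         ≡⟨ closedForm-shift n ⟩
    closedForm (suc n) (k₁ * suc n)   ≡⟨ cong (closedForm (suc n)) (ℕ.+-identityʳ _) ⟨
    closedForm (suc n) (k₁ * suc n + 0) ∎
  ballot-closedForm (suc n) (suc m) = begin
    ballot (suc n) (suc m) ℤ.+ ballot n (suc m + k)
      ≡⟨ cong₂ ℤ._+_ (ballot-closedForm (suc n) m) (ballot-closedForm n (m + k)) ⟩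
    closedForm (suc n) (k₁ * suc n + m) ℤ.+ closedForm n (k₁ * n + (m + k))
      ≡⟨ cong (λ u → closedForm (suc n) (k₁ * suc n + m) ℤ.+ closedForm n u) (index k₁ n m) ⟩
    closedForm (suc n) (k₁ * suc n + m) ℤ.+ closedForm n (suc (k₁ * suc n + m))
      ≡⟨ closedForm-step n (k₁ * suc n + m) ⟩
    closedForm (suc n) (suc (k₁ * suc n + m))
      ≡⟨ cong (closedForm (suc n)) (ℕ.+-suc _ m) ⟨
    closedForm (suc n) (k₁ * suc n + suc m) ∎
    where
    index : ∀ k₁ n m → k₁ * n + (m + suc k₁) ≡ suc (k₁ * suc n + m)
    index = ℕ-Solver.solve-∀

  catalanGF≡ballot : ∀ n → catalanGF k n ≡ ballot n 1
  catalanGF≡ballot zero    rewrite ℕ.*-zeroʳ k = refl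
  catalanGF≡ballot (suc j) = begin
    + ((suc (k * n) C n) / suc (k * n))   ≡⟨ cong (λ c → + (c / suc (k * n))) binomial ⟩
    + ((Y + X) / suc (k * n))             ≡⟨ [1+d]*z≡c⇒c/[1+d]≡z (k * n) _ _ numerator ⟩
    + X ℤ.- + k₁ ℤ.* + Y                  ≡⟨ cong (closedForm n) (ℕ.+-identityʳ _) ⟨
    closedForm n (k₁ * n + 0)             ≡⟨ ballot-closedForm n 0 ⟨
    ballot n 1                            ∎
    where
    n = suc j
    X = pascal n (k₁ * n)
    Y = pascal j (suc (k₁ * n))
    binomial : suc (k * n) C n ≡ Y + X
    binomial = trans (cong (_C n) (sym (ℕ.+-suc n (k₁ * n)))) (C≡pascal n (suc (k₁ * n)))
    absorb : + n ℤ.* + X ≡ (+ 1 ℤ.+ + k₁ ℤ.* + n) ℤ.* + Y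
    absorb = begin
      + n ℤ.* + X                        ≡⟨ ℤ.pos-* n X ⟨
      + (n * X)                          ≡⟨ cong +_ (pascal-absorb j (k₁ * n)) ⟩
      + (suc (k₁ * n) * Y)               ≡⟨ ℤ.pos-* (suc (k₁ * n)) Y ⟩
      (+ 1 ℤ.+ + (k₁ * n)) ℤ.* + Y       ≡⟨ cong (λ z → (+ 1 ℤ.+ z) ℤ.* + Y) (ℤ.pos-* k₁ n) ⟩
      (+ 1 ℤ.+ + k₁ ℤ.* + n) ℤ.* + Y     ∎
    -- (kn+1)(X - k₁ Y) = Y + X + k (n X - (1 + k₁ n) Y), and the bracket vanishes.
    numerator : + suc (k * n) ℤ.* (+ X ℤ.- + k₁ ℤ.* + Y) ≡ + (Y + X)
    numerator = begin
      + suc (k * n) ℤ.* (+ X ℤ.- + k₁ ℤ.* + Y)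
        ≡⟨ cong (λ z → (+ 1 ℤ.+ (+ n ℤ.+ z)) ℤ.* (+ X ℤ.- + k₁ ℤ.* + Y)) (ℤ.pos-* k₁ n) ⟩
      (+ 1 ℤ.+ (+ n ℤ.+ + k₁ ℤ.* + n)) ℤ.* (+ X ℤ.- + k₁ ℤ.* + Y)
        ≡⟨ expand (+ n) (+ k₁) (+ X) (+ Y) ⟩
      (+ Y ℤ.+ + X) ℤ.+ (+ 1 ℤ.+ + k₁) ℤ.* (+ n ℤ.* + X ℤ.- (+ 1 ℤ.+ + k₁ ℤ.* + n) ℤ.* + Y)
        ≡⟨ cong (λ z → (+ Y ℤ.+ + X) ℤ.+ (+ 1 ℤ.+ + k₁) ℤ.* (z ℤ.- (+ 1 ℤ.+ + k₁ ℤ.* + n) ℤ.* + Y)) absorb ⟩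
      (+ Y ℤ.+ + X) ℤ.+ (+ 1 ℤ.+ + k₁) ℤ.* ((+ 1 ℤ.+ + k₁ ℤ.* + n) ℤ.* + Y ℤ.- (+ 1 ℤ.+ + k₁ ℤ.* + n) ℤ.* + Y)
        ≡⟨ cancel (+ Y ℤ.+ + X) (+ 1 ℤ.+ + k₁) ((+ 1 ℤ.+ + k₁ ℤ.* + n) ℤ.* + Y) ⟩
      + Y ℤ.+ + X ∎
      where
      expand : ∀ N K X Y → (+ 1 ℤ.+ (N ℤ.+ K ℤ.* N)) ℤ.* (X ℤ.- K ℤ.* Y)
             ≡ (Y ℤ.+ X) ℤ.+ (+ 1 ℤ.+ K) ℤ.* (N ℤ.* X ℤ.- (+ 1 ℤ.+ K ℤ.* N) ℤ.* Y)
      expand = ℤ-Solver.solve-∀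
      cancel : ∀ a b c → a ℤ.+ b ℤ.* (c ℤ.- c) ≡ a
      cancel = ℤ-Solver.solve-∀

  ballotSeries : ℕ → ℕ → ℤ
  ballotSeries m n = ballot n m

  ballot-convolution : ∀ n m → _⋆_ ℤ.+-*-semiring (ballotSeries 1) (ballotSeries m) n ≡ ballot n (suc m)
  ballot-convolution n       zero     = trans (sumTo-cong n (λ j _ → cong (ballot j 1 ℤ.*_) (ballot-zero (n ∸ j))))
                                              (⋆-identityʳ ℤ.+-*-semiring (ballotSeries 1) n)
    where
    ballot-zero : ∀ n → ballot n 0 ≡ δ ℤ.+-*-semiring n
    ballot-zero zero    = refl
    ballot-zero (suc n) = refl
  ballot-convolution zero    (suc m)  = refl
  ballot-convolution (suc n) (suc m) = begin
    sumTo n (λ j → ballot j 1 ℤ.* ballot (suc n ∸ j) (suc m)) ℤ.+ ballot (suc n) 1 ℤ.* ballot (suc n ∸ suc n) (suc m)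
      ≡⟨ cong₂ ℤ._+_ (trans (sumTo-cong n split) (sumTo-+ n ψ χ)) last ⟩
    (sumTo n ψ ℤ.+ sumTo n χ) ℤ.+ ψ (suc n)
      ≡⟨ regroup (sumTo n ψ) (sumTo n χ) (ψ (suc n)) ⟩
    (sumTo n ψ ℤ.+ ψ (suc n)) ℤ.+ sumTo n χ
      ≡⟨ cong₂ ℤ._+_ (ballot-convolution (suc n) m) (ballot-convolution n (m + k)) ⟩
    ballot (suc n) (suc (suc m)) ∎
    where
    ψ χ : ℕ → ℤ
    ψ j = ballot j 1 ℤ.* ballot (suc n ∸ j) m
    χ j = ballot j 1 ℤ.* ballot (n ∸ j) (m + k)
    split : ∀ j → j ≤ n → ballot j 1 ℤ.* ballot (suc n ∸ j) (suc m) ≡ ψ j ℤ.+ χ j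
    split j j≤n rewrite ℕ.+-∸-assoc 1 j≤n = ℤ.*-distribˡ-+ (ballot j 1) _ _
    last : ballot (suc n) 1 ℤ.* ballot (suc n ∸ suc n) (suc m) ≡ ψ (suc n)
    last rewrite ℕ.n∸n≡0 n = refl
    regroup : ∀ a b c → (a ℤ.+ b) ℤ.+ c ≡ (a ℤ.+ c) ℤ.+ b
    regroup = ℤ-Solver.solve-∀

  catalanGF-^ : ∀ m n → (catalanGF k ^₁ m) n ≡ ballot n m
  catalanGF-^ zero    zero    = refl
  catalanGF-^ zero    (suc n) = refl
  catalanGF-^ (suc m) n = begin
    (catalanGF k *₁ (catalanGF k ^₁ m)) n                        ≡⟨ *₁≡⋆ (catalanGF k) (catalanGF k ^₁ m) n ⟩
    _⋆_ ℤ.+-*-semiring (catalanGF k) (catalanGF k ^₁ m) n        ≡⟨ Semiring.*-cong ℤ⟦t⟧ {catalanGF k} {ballotSeries 1} {catalanGF k ^₁ m} {ballotSeries m}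
                                                                      catalanGF≡ballot (catalanGF-^ m) n ⟩
    _⋆_ ℤ.+-*-semiring (ballotSeries 1) (ballotSeries m) n       ≡⟨ ballot-convolution n m ⟩
    ballot n (suc m)                                             ∎

*₃-1-q+qᵏt : ∀ F k a b n → (F *₃ ((one₃ -₃ mono 1 0 0) +₃ mono k 0 1)) a b n ≡
  F a b n ℤ.- (if 1 ≤ᵇ a then F (a ∸ 1) b n else + 0)
          ℤ.+ (if k ≤ᵇ a then (if 1 ≤ᵇ n then F (a ∸ k) b (n ∸ 1) else + 0) else + 0)
*₃-1-q+qᵏt F k a b n = begin
  (F *₃ ((one₃ -₃ mono 1 0 0) +₃ mono k 0 1)) a b n
    ≡⟨ *₃-distribˡ-+₃ F (one₃ -₃ mono 1 0 0) (mono k 0 1) a b n ⟩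
  (F *₃ (one₃ -₃ mono 1 0 0)) a b n ℤ.+ (F *₃ mono k 0 1) a b n
    ≡⟨ cong (ℤ._+ (F *₃ mono k 0 1) a b n) (*₃-distribˡ-minus₃ F one₃ (mono 1 0 0) a b n) ⟩
  (F *₃ one₃) a b n ℤ.- (F *₃ mono 1 0 0) a b n ℤ.+ (F *₃ mono k 0 1) a b n
    ≡⟨ cong₂ (λ x y → x ℤ.- y ℤ.+ (F *₃ mono k 0 1) a b n) (*₃-mono F 0 0 0 a b n) (*₃-mono F 1 0 0 a b n) ⟩
  F a b n ℤ.- (if 1 ≤ᵇ a then F (a ∸ 1) b n else + 0) ℤ.+ (F *₃ mono k 0 1) a b n
    ≡⟨ cong (λ z → F a b n ℤ.- (if 1 ≤ᵇ a then F (a ∸ 1) b n else + 0) ℤ.+ z) (*₃-mono F k 0 1 a b n) ⟩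
  F a b n ℤ.- (if 1 ≤ᵇ a then F (a ∸ 1) b n else + 0)
          ℤ.+ (if k ≤ᵇ a then (if 1 ≤ᵇ n then F (a ∸ k) b (n ∸ 1) else + 0) else + 0) ∎

numer-coefficient : ∀ k a b n → numer k a b n ≡ (embT (catalanGF k ^₁ suc b) -₃ mono (suc b) 0 0) a 0 n
numer-coefficient k a b n = begin
  numer k a b n                                     ≡⟨ *₃-mono (term b) 0 b 0 a b n ⟩
  (if b ≤ᵇ b then term b a (b ∸ b) n else + 0)      ≡⟨ cong (if_then term b a (b ∸ b) n else + 0) (≤ᵇ-refl b) ⟩
  term b a (b ∸ b) n                                ≡⟨ cong (λ j → term b a j n) (ℕ.n∸n≡0 b) ⟩
  term b a 0 n                                      ∎
  where
  term : ℕ → Series3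
  term i = embT (catalanGF k ^₁ suc i) -₃ mono (suc i) 0 0
  ≤ᵇ-refl : ∀ n → (n ≤ᵇ n) ≡ true
  ≤ᵇ-refl zero    = refl
  ≤ᵇ-refl (suc n) = trans (suc-≤ᵇ-suc n n) (≤ᵇ-refl n)

module _ (k₁ : ℕ) where

  open Walks k₁
  open Ballot k₁ hiding (k)

  raised-from-zero : ∀ n β → + raised β n 0 ≡ ballot n (suc β)
  raised-from-zero zero    β rewrite ℕ.*-zeroʳ k = cong +_ (walksℕ-up β)
  raised-from-zero (suc n) zero    = begin
    + walksℕ 0 (suc (n + k₁ * suc n + 0)) (suc n) 0   ≡⟨ cong +_ (walksℕ-last (n + k₁ * suc n + 0) 0 (suc n) 0) ⟩
    + walksℕ k₁ (n + k₁ * suc n + 0) n 0              ≡⟨ cong (λ L → + walksℕ k₁ L n 0) (walkLength k₁ n) ⟩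
    + raised k₁ n 0                                   ≡⟨ raised-from-zero n k₁ ⟩
    ballot n k                                        ≡⟨ ℤ.+-identityˡ _ ⟨
    ballot (suc n) 1                                  ∎
    where
    walkLength : ∀ k₁ n → n + k₁ * suc n + 0 ≡ suc k₁ * n + k₁
    walkLength = ℕ-Solver.solve-∀
  raised-from-zero (suc n) (suc β) = begin
    + walksℕ (suc β) (suc L) (suc n) 0
      ≡⟨ cong +_ (walksℕ-last L (suc β) (suc n) 0) ⟩
    + walksℕ β L (suc n) 0 ℤ.+ + walksℕ (suc β + k₁) L n 0
      ≡⟨ cong₂ (λ L₁ L₂ → + walksℕ β L₁ (suc n) 0 ℤ.+ + walksℕ (suc β + k₁) L₂ n 0)
               (walkLength₁ k₁ n β) (walkLength₂ k₁ n β) ⟩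
    + raised β (suc n) 0 ℤ.+ + raised (suc β + k₁) n 0
      ≡⟨ cong₂ ℤ._+_ (raised-from-zero (suc n) β) (raised-from-zero n (suc β + k₁)) ⟩
    ballot (suc n) (suc β) ℤ.+ ballot n (suc (suc β + k₁))
      ≡⟨ cong (λ m → ballot (suc n) (suc β) ℤ.+ ballot n (suc m)) (ℕ.+-suc β k₁) ⟨
    ballot (suc n) (suc (suc β)) ∎
    where
    L = n + k₁ * suc n + suc β
    walkLength₁ : ∀ k₁ n β → n + k₁ * suc n + suc β ≡ suc k₁ * suc n + β
    walkLength₁ = ℕ-Solver.solve-∀
    walkLength₂ : ∀ k₁ n β → n + k₁ * suc n + suc β ≡ suc k₁ * n + (suc β + k₁)
    walkLength₂ = ℕ-Solver.solve-∀

  dyckGF≡raised : ∀ a b n → dyckGF k a b n ≡ + raised b n a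
  dyckGF≡raised a b n = cong +_ (dyckCount≡raised n a b)

  dyckGF-*₃-denom : (dyckGF k *₃ denom k) ≈₃ numer k
  dyckGF-*₃-denom zero b n = begin
    (dyckGF k *₃ denom k) 0 b n                 ≡⟨ *₃-1-q+qᵏt (dyckGF k) k 0 b n ⟩
    dyckGF k 0 b n ℤ.- + 0 ℤ.+ + 0              ≡⟨ x-0+0≡x (dyckGF k 0 b n) ⟩
    dyckGF k 0 b n                              ≡⟨ dyckGF≡raised 0 b n ⟩
    + raised b n 0                              ≡⟨ raised-from-zero n b ⟩
    ballot n (suc b)                            ≡⟨ catalanGF-^ (suc b) n ⟨
    (catalanGF k ^₁ suc b) n                    ≡⟨ ℤ.+-identityʳ _ ⟨
    (catalanGF k ^₁ suc b) n ℤ.- + 0            ≡⟨ numer-coefficient k 0 b n ⟨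
    numer k 0 b n                               ∎
    where
    x-0+0≡x : ∀ x → x ℤ.- + 0 ℤ.+ + 0 ≡ x
    x-0+0≡x = ℤ-Solver.solve-∀
  dyckGF-*₃-denom (suc a) b n = begin
    (dyckGF k *₃ denom k) (suc a) b n
      ≡⟨ *₃-1-q+qᵏt (dyckGF k) k (suc a) b n ⟩
    X (suc a) ℤ.- X a ℤ.+ (if k ≤ᵇ suc a then (if 1 ≤ᵇ n then dyckGF k (a ∸ k₁) b (n ∸ 1) else + 0) else + 0)
      ≡⟨ cong₂ (λ x y → x ℤ.+ y) (cong₂ ℤ._-_ (dyckGF≡raised (suc a) b n) (dyckGF≡raised a b n)) startingDown ⟩
    + Rₐ ℤ.- + raised b n a ℤ.+ + Dₐ
      ≡⟨ cong (λ z → + Rₐ ℤ.- z ℤ.+ + Dₐ)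
              (trans (cong +_ (raised-first b n a)) (trans (ℤ.pos-+ (Rₐ + Dₐ) Iₐ) (cong (ℤ._+ + Iₐ) (ℤ.pos-+ Rₐ Dₐ)))) ⟩
    + Rₐ ℤ.- (+ Rₐ ℤ.+ + Dₐ ℤ.+ + Iₐ) ℤ.+ + Dₐ
      ≡⟨ cancel (+ Rₐ) (+ Dₐ) (+ Iₐ) ⟩
    + 0 ℤ.- + Iₐ
      ≡⟨ cong (λ z → + 0 ℤ.- z) (if-float +_ ((a ≡ᵇ b) ∧ (n ≡ᵇ 0))) ⟩
    + 0 ℤ.- (if (a ≡ᵇ b) ∧ (n ≡ᵇ 0) then + 1 else + 0)
      ≡⟨ numer-coefficient k (suc a) b n ⟨
    numer k (suc a) b n ∎
    where
    X : ℕ → ℤ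
    X a = dyckGF k a b n
    Rₐ = raised b n (suc a)
    Dₐ = raisedStartingDown b n a
    Iₐ = if (a ≡ᵇ b) ∧ (n ≡ᵇ 0) then 1 else 0
    cancel : ∀ r d i → r ℤ.- (r ℤ.+ d ℤ.+ i) ℤ.+ d ≡ + 0 ℤ.- i
    cancel = ℤ-Solver.solve-∀
    startingDown : (if k ≤ᵇ suc a then (if 1 ≤ᵇ n then dyckGF k (a ∸ k₁) b (n ∸ 1) else + 0) else + 0) ≡ + Dₐ
    startingDown = begin
      (if k ≤ᵇ suc a then (if 1 ≤ᵇ n then dyckGF k (a ∸ k₁) b (n ∸ 1) else + 0) else + 0)
        ≡⟨ cong (if_then (if 1 ≤ᵇ n then dyckGF k (a ∸ k₁) b (n ∸ 1) else + 0) else + 0) (suc-≤ᵇ-suc k₁ a) ⟩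
      (if k₁ ≤ᵇ a then (if 1 ≤ᵇ n then dyckGF k (a ∸ k₁) b (n ∸ 1) else + 0) else + 0)
        ≡⟨ cong (λ z → if k₁ ≤ᵇ a then (if 1 ≤ᵇ n then z else + 0) else + 0) (dyckGF≡raised (a ∸ k₁) b (n ∸ 1)) ⟩
      (if k₁ ≤ᵇ a then (if 1 ≤ᵇ n then + raised b (n ∸ 1) (a ∸ k₁) else + 0) else + 0)
        ≡⟨ cong (if k₁ ≤ᵇ a then_else + 0) (if-float +_ (1 ≤ᵇ n)) ⟨
      (if k₁ ≤ᵇ a then + (if 1 ≤ᵇ n then raised b (n ∸ 1) (a ∸ k₁) else 0) else + 0)
        ≡⟨ if-float +_ (k₁ ≤ᵇ a) ⟨
      + Dₐ ∎

theorem2p2 : (k : ℕ) → 2 ≤ k → (E : Series3) → (denom k *₃ E) ≈₃ one₃ →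
    dyckGF k ≈₃ (numer k *₃ E)
theorem2p2 zero    ()
theorem2p2 (suc k₁) _ E denom*E≈1 a b n =
  trans (x*d≈y∧d*e≈1⇒x≈y*e ℤ⟦q,r,t⟧ {dyckGF k} {denom k} {numer k} {E} X*denom≈numer denom*E≈1₃ a b n)
        (sym (*₃≡⋆₃ (numer k) E a b n))
  where
  k = suc k₁
  X*denom≈numer : Semiring._≈_ ℤ⟦q,r,t⟧ (dyckGF k ⋆₃ denom k) (numer k)
  X*denom≈numer a b n = trans (sym (*₃≡⋆₃ (dyckGF k) (denom k) a b n)) (dyckGF-*₃-denom k₁ a b n)
  denom*E≈1₃ : Semiring._≈_ ℤ⟦q,r,t⟧ (denom k ⋆₃ E) 1₃
  denom*E≈1₃ a b n = trans (sym (*₃≡⋆₃ (denom k) E a b n)) (trans (denom*E≈1 a b n) (one₃≡1₃ a b n))
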